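{- Let $G=(A\cup B,E)$ be a brace and $X\subseteq V(G)$ with $\operatorname{mp}(\partial(X))=2$ and $4\le|X|\le|V(G)|-4$. Then $\bigl||X\cap A|-|X\cap B|\bigr|=2$.
   Context: All graphs are finite and simple. $\mathcal{M}(G)$ is the set of perfect matchings of $G$; $G$ is matching covered if connected and every edge lies in a perfect matching. For nonempty $X\subseteq V(G)$, $\partial(X)$ is the set of edges with exactly one endpoint in $X$, and $\operatorname{mp}(\partial(X))=\max_{M\in\mathcal{M}(G)}|M\cap\partial(X)|$. A cut $\partial(Z)$ is tight if $|M\cap\partial(Z)|=1$ for all $M\in\mathcal{M}(G)$, nontrivial if both shores have at least two vertices; a brace is a bipartite matching covered graph (colour classes $A,B$) with no nontrivial tight cut. -}

module Defs where

open import Data.Nat using (ℕ; zero; suc; _≤_; _∸_; ∣_-_∣; _<ᵇ_)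
open import Data.Bool using (Bool; true; false; _∧_; not; _xor_)
open import Data.Fin using (Fin; toℕ)
open import Data.List using (List; []; _∷_; allFin; cartesianProduct)
open import Data.Product using (Σ; _×_; _,_; proj₁; proj₂)
open import Relation.Binary.PropositionalEquality using (_≡_; _≢_)
open import Relation.Nullary using (¬_)

count : {A : Set} → (A → Bool) → List A → ℕ
count p []       = 0
count p (x ∷ xs) with p x
... | true  = suc (count p xs)
... | false = count p xs

record Graph (n : ℕ) : Set where
  field
    adj    : Fin n → Fin n → Bool
    sym    : ∀ u v → adj u v ≡ adj v u
    irrefl : ∀ v → adj v v ≡ false
open Graph public

VSet : ℕ → Set
VSet n = Fin n → Bool

∣_∣ᵥ : {n : ℕ} → VSet n → ℕ
∣_∣ᵥ {n} X = count X (allFin n)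

_∩_ : {n : ℕ} → VSet n → VSet n → VSet n
(X ∩ Y) v = X v ∧ Y v

compl : {n : ℕ} → VSet n → VSet n
compl X v = not (X v)

-- Edge sets: Boolean symmetric relations (an edge uv is recorded as F u v = F v u = true).
ESet : ℕ → Set
ESet n = Fin n → Fin n → Bool

-- |F ∩ ∂(X)|: number of edges {u,v} (counted once, u < v) of F with exactly one end in X.
cutCount : {n : ℕ} → ESet n → VSet n → ℕ
cutCount {n} F X =
  count (λ p → (toℕ (proj₁ p) <ᵇ toℕ (proj₂ p)) ∧ F (proj₁ p) (proj₂ p) ∧ (X (proj₁ p) xor X (proj₂ p)))
        (cartesianProduct (allFin n) (allFin n))

record IsPerfectMatching {n : ℕ} (G : Graph n) (M : ESet n) : Set where
  field
    sub    : ∀ u v → M u v ≡ true → adj G u v ≡ true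
    msym   : ∀ u v → M u v ≡ M v u
    unique : ∀ v → Σ (Fin n) λ u → (M v u ≡ true) × (∀ w → M v w ≡ true → w ≡ u)

data Reach {n : ℕ} (G : Graph n) : Fin n → Fin n → Set where
  here : ∀ {v} → Reach G v v
  step : ∀ {u v w} → adj G u v ≡ true → Reach G v w → Reach G u w

Connected : {n : ℕ} → Graph n → Set
Connected {n} G = ∀ (u v : Fin n) → Reach G u v

MatchingCovered : {n : ℕ} → Graph n → Set
MatchingCovered {n} G =
  Connected G ×
  (∀ (u v : Fin n) → adj G u v ≡ true →
     Σ (ESet n) λ M → IsPerfectMatching G M × (M u v ≡ true))

Tight : {n : ℕ} → Graph n → VSet n → Set
Tight {n} G Z = ∀ (M : ESet n) → IsPerfectMatching G M → cutCount M Z ≡ 1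

Nontrivial : {n : ℕ} → VSet n → Set
Nontrivial Z = (2 ≤ ∣ Z ∣ᵥ) × (2 ≤ ∣ compl Z ∣ᵥ)

-- Bipartite with colour classes A = {v | col v = true}, B = {v | col v = false}.
ProperColouring : {n : ℕ} → Graph n → VSet n → Set
ProperColouring {n} G col = ∀ (u v : Fin n) → adj G u v ≡ true → col u ≢ col v

IsBrace : {n : ℕ} → Graph n → VSet n → Set
IsBrace {n} G col =
  ProperColouring G col × MatchingCovered G ×
  (∀ (Z : VSet n) → Nontrivial Z → ¬ Tight G Z)

-- mp(∂(X)) = k : the maximum of |M ∩ ∂(X)| over perfect matchings M equals k.
MpEq : {n : ℕ} → Graph n → VSet n → ℕ → Set
MpEq {n} G X k =
  (Σ (ESet n) λ M → IsPerfectMatching G M × (cutCount M X ≡ k)) ×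
  (∀ (M : ESet n) → IsPerfectMatching G M → cutCount M X ≤ k)

-- A perfect matching M pairs the colour classes inside X as well as across ∂(X), so
-- |X ∩ A| − |X ∩ B| is the number of vertices of X ∩ A minus the number of vertices of
-- X ∩ B that M matches out of X.  For a perfect matching meeting ∂(X) in mp(∂(X)) = 2
-- edges this gives ||X ∩ A| − |X ∩ B|| ∈ {0, 2}, and it remains to exclude 0.
-- In a brace every nonempty S ⊆ A missing at least two vertices of A has |N(S)| ≥ |S| + 2:
-- otherwise S ∪ N(S), enlarged by one more vertex of A when |N(S)| = |S|, is a nontrivial
-- tight cut.  If |X ∩ A| = |X ∩ B|, this surplus applied to X ∩ A and to B ∖ X yields two
-- disjoint edges from X ∩ A to B ∖ X, and Hall's theorem extends them to a perfect
-- matching.  It matches two vertices of X ∩ A out of X, hence by the balance above also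
-- two vertices of X ∩ B, and so meets ∂(X) in at least four edges.
module Submission where

open import Defs hiding (sym)
open import Algebra.Bundles using (CommutativeMonoid)
open import Data.Bool using (Bool; true; false; _∧_; _∨_; not; _xor_; if_then_else_)
open import Data.Bool.Properties
  using (¬-not; not-injective; not-involutive; ∨-comm; ∨-zeroʳ; ∧-identityʳ; ∧-zeroʳ; ∧-comm; ∧-commutativeMonoid)
  renaming (_≟_ to _≟ᵇ_)
open import Data.Empty using (⊥; ⊥-elim)
open import Data.Fin using (Fin; zero; suc; toℕ)
open import Data.Fin.Properties using (_≟_; suc-injective; toℕ-injective; any?; all?)
open import Data.List using (List; []; _∷_; _++_; map; tabulate; allFin; cartesianProduct)
open import Data.Nat using (ℕ; zero; suc; pred; _+_; _∸_; _≤_; _<_; _<ᵇ_; z≤n; s≤s; s≤s⁻¹; ∣_-_∣)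
open import Data.Nat.Properties
  using (≤-refl; ≤-reflexive; ≤-trans; ≤-antisym; ≤-pred; _≤?_; _<?_; ≰⇒>; <⇒≢; 1+n≰n; n≤1+n; n<1+n;
         m≤n⇒m≤1+n; m≤n⇒m<n∨m≡n; m≤m+n; m≤n+m; m∸n≤m; m≤o∸n⇒m+n≤o; +-suc; +-assoc; +-comm;
         +-identityʳ; +-cancelˡ-≡; +-cancelʳ-≡; +-cancelˡ-≤; +-mono-≤; +-monoˡ-≤; ∣m-m+n∣≡n; ∣-∣-comm;
         +-commutativeSemigroup; module ≤-Reasoning)
open import Data.Product using (Σ; ∃; ∃-syntax; _×_; _,_; proj₁; proj₂)
open import Data.Sum using (_⊎_; inj₁; inj₂)
open import Data.Fin.Subset.Properties using (anySubset?)
import Data.Vec as Vec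
open import Data.Vec.Properties using (lookup∘tabulate)
open import Function using (_∘_; id)
open import Data.Nat.Tactic.RingSolver using (solve)
open import Relation.Binary.PropositionalEquality
open import Relation.Nullary using (¬_; Dec; does; yes; no; contradiction)
open import Relation.Nullary.Decidable using (map′; _×-dec_; _→-dec_; dec-true)
open import Algebra.Properties.CommutativeSemigroup +-commutativeSemigroup
  using () renaming (xy∙z≈xz∙y to +-swapʳ)
open import Algebra.Properties.CommutativeSemigroup (CommutativeMonoid.commutativeSemigroup ∧-commutativeMonoid)
  using () renaming (xy∙z≈xz∙y to ∧-swapʳ)

private variable
  n : ℕ

-- Vertex sets

infix 4 _∈_ _∉_ _⊆_ _≐_
infixl 7 _─_
infixr 6 _∪_

-- A record rather than `X v ≡ true`, so that the set can be recovered from a membership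
-- proof by unification.
record _∈_ (v : Fin n) (X : VSet n) : Set where
  constructor member
  field holds : X v ≡ true
open _∈_ public

_∉_ : Fin n → VSet n → Set
v ∉ X = ¬ v ∈ X

_⊆_ : VSet n → VSet n → Set
X ⊆ Y = ∀ {v} → v ∈ X → v ∈ Y

_≐_ : VSet n → VSet n → Set
X ≐ Y = ∀ v → X v ≡ Y v

∅ : VSet n
∅ _ = false

_∪_ : VSet n → VSet n → VSet n
(X ∪ Y) v = X v ∨ Y v

⁅_⁆ : Fin n → VSet n
⁅ y ⁆ v = does (v ≟ y)

_─_ : VSet n → Fin n → VSet n
X ─ y = X ∩ compl ⁅ y ⁆

module _ {X Y : VSet n} {v : Fin n} where

  ∩⁺ : v ∈ X → v ∈ Y → v ∈ X ∩ Y
  ∩⁺ (member p) (member q) = member (subst (λ b → b ∧ Y v ≡ true) (sym p) q)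

  ∩⁻ˡ : v ∈ X ∩ Y → v ∈ X
  ∩⁻ˡ (member p) with X v in x
  ... | true = member x

  ∩⁻ʳ : v ∈ X ∩ Y → v ∈ Y
  ∩⁻ʳ (member p) with X v
  ... | true = member p

  ∪⁺ˡ : v ∈ X → v ∈ X ∪ Y
  ∪⁺ˡ (member p) = member (subst (λ b → b ∨ Y v ≡ true) (sym p) refl)

  ∪⁺ʳ : v ∈ Y → v ∈ X ∪ Y
  ∪⁺ʳ (member q) = member (subst (λ b → X v ∨ b ≡ true) (sym q) (∨-zeroʳ (X v)))

  ∪⁻ : v ∈ X ∪ Y → v ∈ X ⊎ v ∈ Y
  ∪⁻ (member p) with X v in x
  ... | true  = inj₁ (member x)
  ... | false = inj₂ (member p)

module _ {X : VSet n} {v : Fin n} where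

  compl⁺ : v ∉ X → v ∈ compl X
  compl⁺ v∉X with X v in x
  ... | true  = ⊥-elim (v∉X (member x))
  ... | false = member (cong not x)

  compl⁻ : v ∈ compl X → v ∉ X
  compl⁻ (member p) (member q) with () ← trans (sym p) (cong not q)

  compl-compl⁻ : v ∈ compl (compl X) → v ∈ X
  compl-compl⁻ (member p) = member (trans (sym (not-involutive (X v))) p)

∩-monoˡ : {X X′ Y : VSet n} → X ⊆ X′ → X ∩ Y ⊆ X′ ∩ Y
∩-monoˡ X⊆X′ v∈ = ∩⁺ (X⊆X′ (∩⁻ˡ v∈)) (∩⁻ʳ v∈)

∩-monoʳ : {X Y Y′ : VSet n} → Y ⊆ Y′ → X ∩ Y ⊆ X ∩ Y′
∩-monoʳ Y⊆Y′ v∈ = ∩⁺ (∩⁻ˡ v∈) (Y⊆Y′ (∩⁻ʳ v∈))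

∪-monoʳ : {X Y Y′ : VSet n} → Y ⊆ Y′ → X ∪ Y ⊆ X ∪ Y′
∪-monoʳ Y⊆Y′ v∈ with ∪⁻ v∈
... | inj₁ v∈X = ∪⁺ˡ v∈X
... | inj₂ v∈Y = ∪⁺ʳ (Y⊆Y′ v∈Y)

∘⁺ : {X : VSet n} {f : Fin n → Fin n} {v : Fin n} → f v ∈ X → v ∈ X ∘ f
∘⁺ (member p) = member p

∘⁻ : {X : VSet n} {f : Fin n → Fin n} {v : Fin n} → v ∈ X ∘ f → f v ∈ X
∘⁻ (member p) = member p

∉∅ : {v : Fin n} → v ∉ ∅
∉∅ ()

∈⁅⁆ : (v : Fin n) → v ∈ ⁅ v ⁆
∈⁅⁆ v = member (dec-true (v ≟ v) refl)

∈⁅⁆⁻ : {v y : Fin n} → v ∈ ⁅ y ⁆ → v ≡ y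
∈⁅⁆⁻ {v = v} {y} (member p) with v ≟ y
... | yes v≡y = v≡y

_∈?_ : (v : Fin n) (X : VSet n) → Dec (v ∈ X)
v ∈? X with X v in x
... | true  = yes (member x)
... | false = no λ (member p) → contradiction (trans (sym x) p) λ ()

shift∈ : {X : VSet (suc n)} {v : Fin n} → v ∈ X ∘ suc → suc v ∈ X
shift∈ (member p) = member p

unshift∈ : {X : VSet (suc n)} {v : Fin n} → suc v ∈ X → v ∈ X ∘ suc
unshift∈ (member p) = member p

-- Counting

-- Opaque, so that an equation between counts constrains the counted sets during unification.
opaque

  #_ : VSet n → ℕ
  #_ {zero}  X = 0
  #_ {suc n} X = (if X zero then 1 else 0) + # (X ∘ suc)

  count-tabulate : {A : Set} (p : A → Bool) (f : Fin n → A) → count p (tabulate f) ≡ # (p ∘ f)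
  count-tabulate {zero}  p f = refl
  count-tabulate {suc n} p f with p (f zero)
  ... | true  = cong suc (count-tabulate p (f ∘ suc))
  ... | false = count-tabulate p (f ∘ suc)

  #-cong : {X Y : VSet n} → X ≐ Y → # X ≡ # Y
  #-cong {zero}  X≐Y = refl
  #-cong {suc n} X≐Y = cong₂ _+_ (cong (λ b → if b then 1 else 0) (X≐Y zero)) (#-cong (X≐Y ∘ suc))

  #-mono : {X Y : VSet n} → X ⊆ Y → # X ≤ # Y
  #-mono {zero} X⊆Y = z≤n
  #-mono {suc n} {X} {Y} X⊆Y with X zero in x | Y zero in y
  ... | true  | true  = s≤s (#-mono (unshift∈ ∘ X⊆Y ∘ shift∈))
  ... | false | true  = m≤n⇒m≤1+n (#-mono (unshift∈ ∘ X⊆Y ∘ shift∈))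
  ... | false | false = #-mono (unshift∈ ∘ X⊆Y ∘ shift∈)
  ... | true  | false with () ← trans (sym (holds (X⊆Y (member x)))) y

  #-partition : (X Y : VSet n) → # X ≡ # (X ∩ Y) + # (X ∩ compl Y)
  #-partition {zero}  X Y = refl
  #-partition {suc n} X Y with X zero | Y zero
  ... | true  | true  = cong suc (#-partition (X ∘ suc) (Y ∘ suc))
  ... | true  | false = trans (cong suc (#-partition (X ∘ suc) (Y ∘ suc))) (sym (+-suc _ _))
  ... | false | true  = #-partition (X ∘ suc) (Y ∘ suc)
  ... | false | false = #-partition (X ∘ suc) (Y ∘ suc)

  #-compl : (X : VSet n) → # X + # (compl X) ≡ n
  #-compl {zero}  X = refl
  #-compl {suc n} X with X zero
  ... | true  = cong suc (#-compl (X ∘ suc))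
  ... | false = trans (+-suc _ _) (cong suc (#-compl (X ∘ suc)))

  #-∅ : # (∅ {n}) ≡ 0
  #-∅ {zero}  = refl
  #-∅ {suc n} = #-∅ {n}

  #-⁅⁆ : (y : Fin n) → # ⁅ y ⁆ ≡ 1
  #-⁅⁆ {suc n} zero    = cong suc (#-∅ {n})
  #-⁅⁆ {suc n} (suc y) = #-⁅⁆ y

  #-witness : (X : VSet n) → 1 ≤ # X → ∃ (_∈ X)
  #-witness {suc n} X 1≤#X with X zero in x
  ... | true  = zero , member x
  ... | false = let v , v∈X = #-witness (X ∘ suc) 1≤#X in suc v , shift∈ v∈X

∣∣ᵥ≡# : (X : VSet n) → ∣ X ∣ᵥ ≡ # X
∣∣ᵥ≡# X = count-tabulate X id

⊆⊇⇒≐ : {X Y : VSet n} → X ⊆ Y → Y ⊆ X → X ≐ Y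
⊆⊇⇒≐ {X = X} {Y} X⊆Y Y⊆X v with X v in x | Y v in y
... | true  | true  = refl
... | false | false = refl
... | true  | false with () ← trans (sym (holds (X⊆Y (member x)))) y
... | false | true  with () ← trans (sym (holds (Y⊆X (member y)))) x

#-⊆⊇ : {X Y : VSet n} → X ⊆ Y → Y ⊆ X → # X ≡ # Y
#-⊆⊇ X⊆Y Y⊆X = #-cong (⊆⊇⇒≐ X⊆Y Y⊆X)

#-empty : {X : VSet n} → (∀ {v} → v ∉ X) → # X ≡ 0
#-empty X≡∅ = trans (#-⊆⊇ (⊥-elim ∘ X≡∅) (⊥-elim ∘ ∉∅)) #-∅

#-disjoint-∪ : {X Y : VSet n} → (∀ {v} → v ∈ X → v ∉ Y) → # (X ∪ Y) ≡ # X + # Y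
#-disjoint-∪ {X = X} {Y} disjoint = trans (#-partition (X ∪ Y) X)
  (cong₂ _+_ (#-⊆⊇ ∩⁻ʳ (λ v∈X → ∩⁺ (∪⁺ˡ v∈X) v∈X))
             (#-⊆⊇ in-Y (λ v∈Y → ∩⁺ (∪⁺ʳ v∈Y) (compl⁺ (λ v∈X → disjoint v∈X v∈Y)))))
  where
  in-Y : (X ∪ Y) ∩ compl X ⊆ Y
  in-Y v∈ with ∪⁻ {X = X} (∩⁻ˡ v∈)
  ... | inj₁ v∈X = ⊥-elim (compl⁻ (∩⁻ʳ v∈) v∈X)
  ... | inj₂ v∈Y = v∈Y

#-outside : {S X : VSet n} → S ⊆ X → # X ≡ # S + # (X ∩ compl S)
#-outside {S = S} {X} S⊆X =
  trans (#-partition X S) (cong (_+ # (X ∩ compl S)) (#-⊆⊇ ∩⁻ʳ (λ v∈S → ∩⁺ (S⊆X v∈S) v∈S)))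

#-partitionˡ : (X Y : VSet n) → # Y ≡ # (X ∩ Y) + # (compl X ∩ Y)
#-partitionˡ X Y = trans (#-partition Y X)
  (cong₂ _+_ (#-cong λ v → ∧-comm (Y v) (X v)) (#-cong λ v → ∧-comm (Y v) (not (X v))))

#-remove : {X : VSet n} {y : Fin n} → y ∈ X → # X ≡ suc (# (X ─ y))
#-remove {X = X} {y} y∈X = begin
  # X                         ≡⟨ #-partition X ⁅ y ⁆ ⟩
  # (X ∩ ⁅ y ⁆) + # (X ─ y)  ≡⟨ cong (_+ # (X ─ y)) (trans (#-⊆⊇ ∩⁻ʳ ⁅y⁆⊆X∩⁅y⁆) (#-⁅⁆ y)) ⟩
  suc (# (X ─ y))             ∎
  where
  open ≡-Reasoning
  ⁅y⁆⊆X∩⁅y⁆ : ⁅ y ⁆ ⊆ X ∩ ⁅ y ⁆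
  ⁅y⁆⊆X∩⁅y⁆ v∈⁅y⁆ rewrite ∈⁅⁆⁻ v∈⁅y⁆ = ∩⁺ y∈X (∈⁅⁆ y)

─⁺ : {X : VSet n} {v y : Fin n} → v ∈ X → v ≢ y → v ∈ X ─ y
─⁺ v∈X v≢y = ∩⁺ v∈X (compl⁺ (v≢y ∘ ∈⁅⁆⁻))

─⁻ : {X : VSet n} {v y : Fin n} → v ∈ X ─ y → v ∈ X × v ≢ y
─⁻ v∈X─y = ∩⁻ˡ v∈X─y , λ v≡y → compl⁻ (∩⁻ʳ v∈X─y) (subst (_∈ ⁅ _ ⁆) (sym v≡y) (∈⁅⁆ _))

⊆⁅⁆∪─ : {X : VSet n} {y : Fin n} → X ⊆ ⁅ y ⁆ ∪ (X ─ y)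
⊆⁅⁆∪─ {y = y} {v} v∈X with v ≟ y
... | yes refl = ∪⁺ˡ (∈⁅⁆ y)
... | no  v≢y  = ∪⁺ʳ (─⁺ v∈X v≢y)

⁅⁆∪─⊆ : {X : VSet n} {y : Fin n} → y ∈ X → ⁅ y ⁆ ∪ (X ─ y) ⊆ X
⁅⁆∪─⊆ y∈X v∈ with ∪⁻ v∈
... | inj₁ v∈⁅y⁆ rewrite ∈⁅⁆⁻ v∈⁅y⁆ = y∈X
... | inj₂ v∈X─y = proj₁ (─⁻ v∈X─y)

⁅⁆-─-disjoint : {X : VSet n} {v y : Fin n} → v ∈ ⁅ y ⁆ → v ∉ X ─ y
⁅⁆-─-disjoint v∈⁅y⁆ v∈X─y = proj₂ (─⁻ v∈X─y) (∈⁅⁆⁻ v∈⁅y⁆)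

opaque
  unfolding #_

  #-injection : {m k : ℕ} {X : VSet m} {Y : VSet k} (f : Fin m → Fin k) →
                (∀ {u} → u ∈ X → f u ∈ Y) →
                (∀ {u w} → u ∈ X → w ∈ X → f u ≡ f w → u ≡ w) → # X ≤ # Y
  #-injection {zero}  f maps injective = z≤n
  #-injection {suc m} {X = X} {Y} f maps injective with X zero in x
  ... | false = #-injection (f ∘ suc) (maps ∘ shift∈) (λ p q → suc-injective ∘ injective (shift∈ p) (shift∈ q))
  ... | true  = subst (suc (# (X ∘ suc)) ≤_) (sym (#-remove (maps (member x))))
                  (s≤s (#-injection (f ∘ suc)
                    (λ u∈X → ─⁺ (maps (shift∈ u∈X)) (λ fu≡f0 → 0≢suc (injective (member x) (shift∈ u∈X) (sym fu≡f0))))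
                    (λ p q → suc-injective ∘ injective (shift∈ p) (shift∈ q))))
    where
    0≢suc : ∀ {u : Fin m} → zero ≢ suc u
    0≢suc ()

empty-or-inhabited : (X : VSet n) → (∀ {v} → v ∉ X) ⊎ ∃ (_∈ X)
empty-or-inhabited X with any? (_∈? X)
... | yes v∈X = inj₂ v∈X
... | no  X≡∅ = inj₁ λ {v} v∈X → X≡∅ (v , v∈X)

#-pos : {X : VSet n} {v : Fin n} → v ∈ X → 1 ≤ # X
#-pos v∈X = subst (1 ≤_) (sym (#-remove v∈X)) (s≤s z≤n)

#-≤-suc-remove : (X : VSet n) (y : Fin n) → # X ≤ suc (# (X ─ y))
#-≤-suc-remove X y with y ∈? X
... | yes y∈X = ≤-reflexive (#-remove y∈X)
... | no  y∉X = m≤n⇒m≤1+n (#-mono (λ v∈X → ─⁺ v∈X λ { refl → y∉X v∈X }))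

record TwoElements (X : VSet n) : Set where
  constructor twoElements
  field
    {fst snd} : Fin n
    fst∈      : fst ∈ X
    snd∈      : snd ∈ X
    distinct  : fst ≢ snd

#-two : {X : VSet n} → TwoElements X → 2 ≤ # X
#-two (twoElements v∈X w∈X v≢w) = subst (2 ≤_) (sym (#-remove v∈X)) (s≤s (#-pos (─⁺ w∈X (v≢w ∘ sym))))

two-elements : (X : VSet n) → 2 ≤ # X → TwoElements X
two-elements X 2≤#X =
  let v , v∈X   = #-witness X (≤-trans (s≤s z≤n) 2≤#X)
      w , w∈X─v = #-witness (X ─ v) (s≤s⁻¹ (subst (2 ≤_) (#-remove v∈X) 2≤#X))
      w∈X , w≢v = ─⁻ w∈X─v
  in twoElements v∈X w∈X (w≢v ∘ sym)

#-∘-involution : (m : Fin n → Fin n) → (∀ v → m (m v) ≡ v) → (X : VSet n) → # (X ∘ m) ≡ # X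
#-∘-involution m m∘m X = ≤-antisym
  (#-injection m ∘⁻ (λ _ _ → m-injective))
  (#-injection m (λ {u} u∈X → ∘⁺ (subst (_∈ X) (sym (m∘m u)) u∈X)) (λ _ _ → m-injective))
  where
  m-injective : ∀ {u w} → m u ≡ m w → u ≡ w
  m-injective {u} {w} mu≡mw = trans (sym (m∘m u)) (trans (cong m mu≡mw) (m∘m w))

m+m≡n+n⇒m≡n : ∀ m n → m + m ≡ n + n → m ≡ n
m+m≡n+n⇒m≡n zero    zero    _  = refl
m+m≡n+n⇒m≡n (suc m) (suc n) eq =
  cong suc (m+m≡n+n⇒m≡n m n (cong pred (trans (sym (+-suc m m)) (trans (cong pred eq) (+-suc n n)))))

module Involution (m : Fin n → Fin n) (m∘m : ∀ v → m (m v) ≡ v) where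

  Stable : VSet n → Set
  Stable C = ∀ v → C (m v) ≡ C v

  Flips : VSet n → VSet n → Set
  Flips C P = ∀ {v} → v ∈ C → P (m v) ≡ not (P v)

  #-swap : (C P : VSet n) → Stable C → Flips C P → # (C ∩ P) ≡ # (C ∩ compl P)
  #-swap C P C-stable P-flips = trans (#-cong pointwise) (#-∘-involution m m∘m (C ∩ compl P))
    where
    pointwise : C ∩ P ≐ (C ∩ compl P) ∘ m
    pointwise v rewrite C-stable v with C v in c
    ... | false = refl
    ... | true  = trans (sym (not-involutive (P v))) (cong not (sym (P-flips (member c))))

  #-halves : (C P Q : VSet n) → Stable C → Flips C P → Flips C Q → # (C ∩ P) ≡ # (C ∩ Q)
  #-halves C P Q C-stable P-flips Q-flips = m+m≡n+n⇒m≡n _ _ (begin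
    # (C ∩ P) + # (C ∩ P)         ≡⟨ cong (# (C ∩ P) +_) (#-swap C P C-stable P-flips) ⟩
    # (C ∩ P) + # (C ∩ compl P)   ≡⟨ #-partition C P ⟨
    # C                           ≡⟨ #-partition C Q ⟩
    # (C ∩ Q) + # (C ∩ compl Q)   ≡⟨ cong (# (C ∩ Q) +_) (#-swap C Q C-stable Q-flips) ⟨
    # (C ∩ Q) + # (C ∩ Q)         ∎)
    where open ≡-Reasoning

count-∷ : {A : Set} (p : A → Bool) (x : A) (xs : List A) →
          count p (x ∷ xs) ≡ (if p x then 1 else 0) + count p xs
count-∷ p x xs with p x
... | true  = refl
... | false = refl

count-++ : {A : Set} (p : A → Bool) (xs ys : List A) → count p (xs ++ ys) ≡ count p xs + count p ys
count-++ p []       ys = refl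
count-++ p (x ∷ xs) ys = begin
  count p (x ∷ xs ++ ys)                                ≡⟨ count-∷ p x (xs ++ ys) ⟩
  (if p x then 1 else 0) + count p (xs ++ ys)          ≡⟨ cong (_ +_) (count-++ p xs ys) ⟩
  (if p x then 1 else 0) + (count p xs + count p ys)   ≡⟨ +-assoc (if p x then 1 else 0) _ _ ⟨
  ((if p x then 1 else 0) + count p xs) + count p ys   ≡⟨ cong (_+ count p ys) (count-∷ p x xs) ⟨
  count p (x ∷ xs) + count p ys                         ∎
  where open ≡-Reasoning

count-map : {A B : Set} (p : B → Bool) (f : A → B) (xs : List A) → count p (map f xs) ≡ count (p ∘ f) xs
count-map p f []       = refl
count-map p f (x ∷ xs) with p (f x)
... | true  = cong suc (count-map p f xs)
... | false = count-map p f xs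

count-cartesianProduct : {A B : Set} (p : A × B → Bool) (q : A → Bool) (xs : List A) (ys : List B) →
  (∀ x → count (λ y → p (x , y)) ys ≡ (if q x then 1 else 0)) →
  count p (cartesianProduct xs ys) ≡ count q xs
count-cartesianProduct p q []       ys rows = refl
count-cartesianProduct p q (x ∷ xs) ys rows = begin
  count p (map (x ,_) ys ++ cartesianProduct xs ys)          ≡⟨ count-++ p (map (x ,_) ys) _ ⟩
  count p (map (x ,_) ys) + count p (cartesianProduct xs ys) ≡⟨ cong₂ _+_ (trans (count-map p (x ,_) ys) (rows x))
                                                                          (count-cartesianProduct p q xs ys rows) ⟩
  (if q x then 1 else 0) + count q xs                         ≡⟨ count-∷ q x xs ⟨
  count q (x ∷ xs)                                            ∎
  where open ≡-Reasoning

#-⁅⁆∩ : (w : Fin n) (b : Bool) → # (λ v → ⁅ w ⁆ v ∧ b) ≡ (if b then 1 else 0)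
#-⁅⁆∩ w true  = trans (#-cong (λ v → ∧-identityʳ (⁅ w ⁆ v))) (#-⁅⁆ w)
#-⁅⁆∩ w false = trans (#-cong (λ v → ∧-zeroʳ (⁅ w ⁆ v))) #-∅

<ᵇ-flip : ∀ {x y} → x ≢ y → (y <ᵇ x) ≡ not (x <ᵇ y)
<ᵇ-flip {zero}  {zero}  x≢y = ⊥-elim (x≢y refl)
<ᵇ-flip {zero}  {suc y} _   = refl
<ᵇ-flip {suc x} {zero}  _   = refl
<ᵇ-flip {suc x} {suc y} x≢y = <ᵇ-flip (x≢y ∘ cong suc)

xor-comm : ∀ a b → (a xor b) ≡ (b xor a)
xor-comm true  true  = refl
xor-comm true  false = refl
xor-comm false true  = refl
xor-comm false false = refl

-- Perfect matchings

module Mate {G : Graph n} {M : ESet n} (pm : IsPerfectMatching G M) where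
  open IsPerfectMatching pm

  mate : Fin n → Fin n
  mate v = proj₁ (unique v)

  M-mate : ∀ v → M v (mate v) ≡ true
  M-mate v = proj₁ (proj₂ (unique v))

  mate-unique : ∀ {v w} → M v w ≡ true → w ≡ mate v
  mate-unique {v} {w} = proj₂ (proj₂ (unique v)) w

  mate-involutive : ∀ v → mate (mate v) ≡ v
  mate-involutive v = sym (mate-unique (trans (msym (mate v) v) (M-mate v)))

  adj-mate : ∀ v → adj G v (mate v) ≡ true
  adj-mate v = sub v (mate v) (M-mate v)

  mate-injective : ∀ {u w} → mate u ≡ mate w → u ≡ w
  mate-injective {u} {w} eq = trans (sym (mate-involutive u)) (trans (cong mate eq) (mate-involutive w))

  mate≢ : ∀ v → mate v ≢ v
  mate≢ v mv≡v with () ← trans (sym (adj-mate v)) (trans (cong (adj G v) mv≡v) (irrefl G v))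

  M≡⁅mate⁆ : ∀ v w → M v w ≡ ⁅ mate v ⁆ w
  M≡⁅mate⁆ v w with w ≟ mate v
  ... | yes refl = M-mate v
  ... | no w≢mv with M v w in vw
  ...   | true  = ⊥-elim (w≢mv (mate-unique vw))
  ...   | false = refl

  open Involution mate mate-involutive public

  Internal Leaving Crossing : VSet n → VSet n
  Internal Z = Z ∩ (Z ∘ mate)
  Leaving  Z = Z ∩ compl (Z ∘ mate)
  Crossing Z v = Z v xor Z (mate v)

  Leaving⁺ : ∀ {Z v} → v ∈ Z → mate v ∉ Z → v ∈ Leaving Z
  Leaving⁺ v∈Z mv∉Z = ∩⁺ v∈Z (compl⁺ (mv∉Z ∘ ∘⁻))

  Leaving⁻ : ∀ {Z v} → v ∈ Leaving Z → v ∈ Z × mate v ∉ Z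
  Leaving⁻ {Z} v∈ = ∩⁻ˡ v∈ , compl⁻ (∩⁻ʳ {X = Z} v∈) ∘ ∘⁺

  private
    Below : VSet n
    Below v = toℕ v <ᵇ toℕ (mate v)

    cutCount≡#Below∩Crossing : (Z : VSet n) → cutCount M Z ≡ # (Below ∩ Crossing Z)
    cutCount≡#Below∩Crossing Z =
      trans (count-cartesianProduct _ (Below ∩ Crossing Z) (allFin n) (allFin n) row)
            (count-tabulate (Below ∩ Crossing Z) id)
      where
      edge-at : Fin n → Fin n → Bool
      edge-at u v = (toℕ u <ᵇ toℕ v) ∧ M u v ∧ (Z u xor Z v)
      edge-at≐ : ∀ u → edge-at u ≐ (λ v → ⁅ mate u ⁆ v ∧ (Below ∩ Crossing Z) u)
      edge-at≐ u v rewrite M≡⁅mate⁆ u v with v ≟ mate u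
      ... | yes refl = refl
      ... | no _     = ∧-zeroʳ (toℕ u <ᵇ toℕ v)
      row : ∀ u → count (edge-at u) (allFin n) ≡ (if (Below ∩ Crossing Z) u then 1 else 0)
      row u = trans (count-tabulate (edge-at u) id) (trans (#-cong (edge-at≐ u)) (#-⁅⁆∩ (mate u) _))

  -- cutCount takes each matching edge across ∂(Z) at its smaller end, Leaving at its end in Z:
  -- both select one vertex from every crossing pair {v, mate v}.
  cutCount≡#Leaving : (Z : VSet n) → cutCount M Z ≡ # (Leaving Z)
  cutCount≡#Leaving Z = begin
    cutCount M Z              ≡⟨ cutCount≡#Below∩Crossing Z ⟩
    # (Below ∩ Crossing Z)    ≡⟨ #-cong (λ v → ∧-comm (Below v) _) ⟩
    # (Crossing Z ∩ Below)    ≡⟨ #-halves (Crossing Z) Below Z crossing-stable below-flips Z-flips ⟩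
    # (Crossing Z ∩ Z)        ≡⟨ #-cong (λ v → crossing∧ (Z v) (Z (mate v))) ⟩
    # (Leaving Z)             ∎
    where
    open ≡-Reasoning
    crossing-stable : Stable (Crossing Z)
    crossing-stable v rewrite mate-involutive v = xor-comm (Z (mate v)) (Z v)
    below-flips : Flips (Crossing Z) Below
    below-flips {v} _ rewrite mate-involutive v = <ᵇ-flip (mate≢ v ∘ sym ∘ toℕ-injective)
    Z-flips : Flips (Crossing Z) Z
    Z-flips {v} (member _) with Z v | Z (mate v)
    ... | true  | false = refl
    ... | false | true  = refl
    crossing∧ : ∀ a b → (a xor b) ∧ a ≡ a ∧ not b
    crossing∧ true  b = ∧-identityʳ (not b)
    crossing∧ false b = ∧-zeroʳ (false xor b)

  #-internal-leaving : (Z Y : VSet n) → # (Z ∩ Y) ≡ # (Internal Z ∩ Y) + # (Leaving Z ∩ Y)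
  #-internal-leaving Z Y = trans (#-partition (Z ∩ Y) (Z ∘ mate))
    (cong₂ _+_ (#-cong (λ v → ∧-swapʳ (Z v) (Y v) _)) (#-cong (λ v → ∧-swapʳ (Z v) (Y v) _)))

  module _ {col : VSet n} (proper : ProperColouring G col) where

    col-mate : ∀ v → col (mate v) ≡ not (col v)
    col-mate v = ¬-not (proper v (mate v) (adj-mate v) ∘ sym)

    #-colour-classes : # col ≡ # (compl col)
    #-colour-classes = #-swap (λ _ → true) col (λ _ → refl) (λ {v} _ → col-mate v)

    balance : (Z : VSet n) →
      # (Z ∩ col) + # (Leaving Z ∩ compl col) ≡ # (Z ∩ compl col) + # (Leaving Z ∩ col)
    balance Z = begin
      # (Z ∩ col) + lB                      ≡⟨ cong (_+ lB) (#-internal-leaving Z col) ⟩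
      # (Internal Z ∩ col) + lA + lB        ≡⟨ cong (λ i → i + lA + lB) internal-balanced ⟩
      # (Internal Z ∩ compl col) + lA + lB  ≡⟨ +-swapʳ (# (Internal Z ∩ compl col)) lA lB ⟩
      # (Internal Z ∩ compl col) + lB + lA  ≡⟨ cong (_+ lA) (#-internal-leaving Z (compl col)) ⟨
      # (Z ∩ compl col) + lA                ∎
      where
      open ≡-Reasoning
      lA = # (Leaving Z ∩ col)
      lB = # (Leaving Z ∩ compl col)
      internal-balanced : # (Internal Z ∩ col) ≡ # (Internal Z ∩ compl col)
      internal-balanced = #-swap (Internal Z) col
        (λ v → trans (cong (λ w → Z (mate v) ∧ Z w) (mate-involutive v)) (∧-comm (Z (mate v)) (Z v)))
        (λ {v} _ → col-mate v)

-- Hall's theorem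

⊆? : (X Y : VSet n) → Dec (X ⊆ Y)
⊆? X Y = map′ (λ h {v} → h v) (λ h v → h) (all? (λ v → (v ∈? X) →-dec (v ∈? Y)))

module Hall (R : Fin n → Fin n → Bool) where

  N : VSet n → VSet n
  N S v = does (any? λ u → (u ∈? S) ×-dec (R u v ≟ᵇ true))

  N⁺ : {S : VSet n} {u v : Fin n} → u ∈ S → R u v ≡ true → v ∈ N S
  N⁺ {S} {u} {v} u∈S uRv = member (dec-true (any? λ w → (w ∈? S) ×-dec (R w v ≟ᵇ true)) (u , u∈S , uRv))

  N⁻ : {S : VSet n} {v : Fin n} → v ∈ N S → ∃[ u ] u ∈ S × R u v ≡ true
  N⁻ {S} {v} (member p) with any? (λ w → (w ∈? S) ×-dec (R w v ≟ᵇ true))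
  ... | yes witness = witness

  N-mono : {S S′ : VSet n} → S ⊆ S′ → N S ⊆ N S′
  N-mono S⊆S′ v∈NS = let u , u∈S , uRv = N⁻ v∈NS in N⁺ (S⊆S′ u∈S) uRv

  N-∪ : {S S′ : VSet n} → N (S ∪ S′) ⊆ N S ∪ N S′
  N-∪ v∈N with N⁻ v∈N
  ... | u , u∈S∪S′ , uRv with ∪⁻ u∈S∪S′
  ...   | inj₁ u∈S  = ∪⁺ˡ (N⁺ u∈S uRv)
  ...   | inj₂ u∈S′ = ∪⁺ʳ (N⁺ u∈S′ uRv)

  record Matching (L T : VSet n) : Set where
    field
      partner           : Fin n → Fin n
      partner∈          : ∀ {u} → u ∈ L → partner u ∈ T
      partner-related   : ∀ {u} → u ∈ L → R u (partner u) ≡ true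
      partner-injective : ∀ {u w} → u ∈ L → w ∈ L → partner u ≡ partner w → u ≡ w
  open Matching public

  matching-mono : {L L′ T T′ : VSet n} → L′ ⊆ L → T ⊆ T′ → Matching L T → Matching L′ T′
  matching-mono L′⊆L T⊆T′ m = record
    { partner           = partner m
    ; partner∈          = T⊆T′ ∘ partner∈ m ∘ L′⊆L
    ; partner-related   = partner-related m ∘ L′⊆L
    ; partner-injective = λ u∈L′ w∈L′ → partner-injective m (L′⊆L u∈L′) (L′⊆L w∈L′)
    }

  empty-matching : {L : VSet n} (T : VSet n) → (∀ {u} → u ∉ L) → Matching L T
  empty-matching T L≡∅ = record
    { partner           = id
    ; partner∈          = ⊥-elim ∘ L≡∅
    ; partner-related   = ⊥-elim ∘ L≡∅
    ; partner-injective = λ u∈L → ⊥-elim (L≡∅ u∈L)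
    }

  edge-matching : {u v : Fin n} → R u v ≡ true → Matching ⁅ u ⁆ ⁅ v ⁆
  edge-matching {u} {v} uRv = record
    { partner           = λ _ → v
    ; partner∈          = λ _ → ∈⁅⁆ v
    ; partner-related   = λ w∈⁅u⁆ → subst (λ w → R w v ≡ true) (sym (∈⁅⁆⁻ w∈⁅u⁆)) uRv
    ; partner-injective = λ w∈⁅u⁆ w′∈⁅u⁆ _ → trans (∈⁅⁆⁻ w∈⁅u⁆) (sym (∈⁅⁆⁻ w′∈⁅u⁆))
    }

  module _ {L₁ L₂ T₁ T₂ : VSet n} (m₁ : Matching L₁ T₁) (m₂ : Matching L₂ T₂)
           (disjoint : ∀ {v} → v ∈ T₁ → v ∉ T₂) where

    private
      p : Fin n → Fin n
      p u = if L₁ u then partner m₁ u else partner m₂ u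

      data Side (u : Fin n) : Set where
        left  : u ∈ L₁ → p u ≡ partner m₁ u → Side u
        right : u ∈ L₂ → p u ≡ partner m₂ u → Side u

      side : ∀ {u} → u ∈ L₁ ∪ L₂ → Side u
      side {u} (member u∈L) with L₁ u in u∈?L₁
      ... | true  = left  (member u∈?L₁) (cong (λ b → if b then partner m₁ u else partner m₂ u) u∈?L₁)
      ... | false = right (member u∈L)   (cong (λ b → if b then partner m₁ u else partner m₂ u) u∈?L₁)

      p∈ : ∀ {u} → Side u → p u ∈ T₁ ∪ T₂
      p∈ (left  u∈L₁ eq) = subst (_∈ T₁ ∪ T₂) (sym eq) (∪⁺ˡ (partner∈ m₁ u∈L₁))
      p∈ (right u∈L₂ eq) = subst (_∈ T₁ ∪ T₂) (sym eq) (∪⁺ʳ (partner∈ m₂ u∈L₂))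

      p-related : ∀ {u} → Side u → R u (p u) ≡ true
      p-related {u} (left  u∈L₁ eq) = subst (λ v → R u v ≡ true) (sym eq) (partner-related m₁ u∈L₁)
      p-related {u} (right u∈L₂ eq) = subst (λ v → R u v ≡ true) (sym eq) (partner-related m₂ u∈L₂)

      partners-differ : ∀ {u w} → u ∈ L₁ → w ∈ L₂ → partner m₁ u ≢ partner m₂ w
      partners-differ u∈L₁ w∈L₂ eq = disjoint (partner∈ m₁ u∈L₁) (subst (_∈ T₂) (sym eq) (partner∈ m₂ w∈L₂))

      p-injective : ∀ {u w} → Side u → Side w → p u ≡ p w → u ≡ w
      p-injective (left  u∈ e) (left  w∈ e′) eq = partner-injective m₁ u∈ w∈ (trans (sym e) (trans eq e′))
      p-injective (right u∈ e) (right w∈ e′) eq = partner-injective m₂ u∈ w∈ (trans (sym e) (trans eq e′))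
      p-injective (left  u∈ e) (right w∈ e′) eq = ⊥-elim (partners-differ u∈ w∈ (trans (sym e) (trans eq e′)))
      p-injective (right u∈ e) (left  w∈ e′) eq = ⊥-elim (partners-differ w∈ u∈ (trans (sym e′) (trans (sym eq) e)))

    union : Matching (L₁ ∪ L₂) (T₁ ∪ T₂)
    union = record
      { partner           = p
      ; partner∈          = p∈ ∘ side
      ; partner-related   = p-related ∘ side
      ; partner-injective = λ u∈L w∈L → p-injective (side u∈L) (side w∈L)
      }

    union-partnerˡ : ∀ {u} → u ∈ L₁ → partner union u ≡ partner m₁ u
    union-partnerˡ {u} (member u∈L₁) rewrite u∈L₁ = refl

    union-partnerʳ : ∀ {u} → u ∉ L₁ → partner union u ≡ partner m₂ u
    union-partnerʳ {u} u∉L₁ with L₁ u in u∈?L₁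
    ... | true  = ⊥-elim (u∉L₁ (member u∈?L₁))
    ... | false = refl

  HallCondition : VSet n → VSet n → Set
  HallCondition L T = ∀ S → S ⊆ L → # S ≤ # (T ∩ N S)

  Critical : VSet n → VSet n → VSet n → Set
  Critical L T S = S ⊆ L × 1 ≤ # S × # S < # L × # (T ∩ N S) ≤ # S

  critical? : (L T S : VSet n) → Dec (Critical L T S)
  critical? L T S = ⊆? S L ×-dec 1 ≤? # S ×-dec # S <? # L ×-dec # (T ∩ N S) ≤? # S

  critical-cong : {L T S S′ : VSet n} → S ≐ S′ → Critical L T S → Critical L T S′
  critical-cong {L} {T} {S} {S′} S≐S′ (S⊆L , 1≤#S , #S<#L , deficient) =
    S⊆L ∘ S′⊆S , subst (1 ≤_) #S≡#S′ 1≤#S , subst (_< # L) #S≡#S′ #S<#L ,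
    subst₂ _≤_ (#-⊆⊇ (∩-monoʳ (N-mono S⊆S′)) (∩-monoʳ (N-mono S′⊆S))) #S≡#S′ deficient
    where
    S⊆S′ : S ⊆ S′
    S⊆S′ {v} (member p) = member (trans (sym (S≐S′ v)) p)
    S′⊆S : S′ ⊆ S
    S′⊆S {v} (member p) = member (trans (S≐S′ v) p)
    #S≡#S′ = #-⊆⊇ S⊆S′ S′⊆S

  condition-inside : ∀ {L T S} → S ⊆ L → HallCondition L T → HallCondition S (T ∩ N S)
  condition-inside {T = T} {S} S⊆L condition S′ S′⊆S =
    ≤-trans (condition S′ (S⊆L ∘ S′⊆S)) (#-mono part-neighbours)
    where
    part-neighbours : T ∩ N S′ ⊆ (T ∩ N S) ∩ N S′
    part-neighbours v∈ = ∩⁺ (∩-monoʳ (N-mono S′⊆S) v∈) (∩⁻ʳ v∈)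

  condition-outside : ∀ {L T S} → S ⊆ L → # (T ∩ N S) ≤ # S → HallCondition L T →
                      HallCondition (L ∩ compl S) (T ∩ compl (N S))
  condition-outside {L} {T} {S} S⊆L deficient condition S′ S′⊆Rest = +-cancelˡ-≤ (# S) _ _ (begin
    # S + # S′                                  ≡⟨ #-disjoint-∪ S∩S′≡∅ ⟨
    # (S ∪ S′)                                  ≤⟨ condition (S ∪ S′) S∪S′⊆L ⟩
    # (T ∩ N (S ∪ S′))                          ≡⟨ #-partition (T ∩ N (S ∪ S′)) (N S) ⟩
    # ((T ∩ N (S ∪ S′)) ∩ N S) + # ((T ∩ N (S ∪ S′)) ∩ compl (N S))
                                                ≤⟨ +-mono-≤ (#-mono old-neighbours) (#-mono new-neighbours) ⟩
    # (T ∩ N S) + # ((T ∩ compl (N S)) ∩ N S′)  ≤⟨ +-monoˡ-≤ (# ((T ∩ compl (N S)) ∩ N S′)) deficient ⟩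
    # S + # ((T ∩ compl (N S)) ∩ N S′)          ∎)
    where
    open ≤-Reasoning
    S∩S′≡∅ : ∀ {v} → v ∈ S → v ∉ S′
    S∩S′≡∅ v∈S v∈S′ = compl⁻ (∩⁻ʳ (S′⊆Rest v∈S′)) v∈S
    S∪S′⊆L : S ∪ S′ ⊆ L
    S∪S′⊆L v∈S∪S′ with ∪⁻ v∈S∪S′
    ... | inj₁ v∈S  = S⊆L v∈S
    ... | inj₂ v∈S′ = ∩⁻ˡ (S′⊆Rest v∈S′)
    old-neighbours : (T ∩ N (S ∪ S′)) ∩ N S ⊆ T ∩ N S
    old-neighbours = ∩-monoˡ (∩⁻ˡ {X = T})
    new-neighbours : (T ∩ N (S ∪ S′)) ∩ compl (N S) ⊆ (T ∩ compl (N S)) ∩ N S′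
    new-neighbours v∈ with ∪⁻ (N-∪ {S} (∩⁻ʳ {X = T} (∩⁻ˡ v∈)))
    ... | inj₁ v∈NS  = ⊥-elim (compl⁻ (∩⁻ʳ {X = T ∩ N (S ∪ S′)} v∈) v∈NS)
    ... | inj₂ v∈NS′ = ∩⁺ (∩⁺ (∩⁻ˡ {X = T} (∩⁻ˡ v∈)) (∩⁻ʳ {X = T ∩ N (S ∪ S′)} v∈)) v∈NS′

  condition-after-edge : ∀ {L T u₀ v₀} → u₀ ∈ L →
                         (∀ S → S ⊆ L → 1 ≤ # S → # S < # L → # S < # (T ∩ N S)) →
                         HallCondition (L ─ u₀) (T ─ v₀)
  condition-after-edge {L} {T} {u₀} {v₀} u₀∈L surplus S S⊆L─u₀ with empty-or-inhabited S
  ... | inj₁ S≡∅ = ≤-trans (≤-reflexive (#-empty S≡∅)) z≤n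
  ... | inj₂ (_ , v∈S) = ≤-pred (begin
    suc (# S)                 ≤⟨ surplus S (proj₁ ∘ ─⁻ ∘ S⊆L─u₀) (#-pos v∈S) #S<#L ⟩
    # (T ∩ N S)               ≤⟨ #-≤-suc-remove (T ∩ N S) v₀ ⟩
    suc (# ((T ∩ N S) ─ v₀))  ≤⟨ s≤s (#-mono reorder) ⟩
    suc (# ((T ─ v₀) ∩ N S))  ∎)
    where
    open ≤-Reasoning
    #S<#L : # S < # L
    #S<#L = ≤-trans (s≤s (#-mono S⊆L─u₀)) (≤-reflexive (sym (#-remove u₀∈L)))
    reorder : (T ∩ N S) ─ v₀ ⊆ (T ─ v₀) ∩ N S
    reorder v∈ = ∩⁺ (─⁺ (∩⁻ˡ (∩⁻ˡ v∈)) (proj₂ (─⁻ v∈))) (∩⁻ʳ {X = T} (∩⁻ˡ v∈))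

  Hall≤ : ℕ → Set
  Hall≤ k = ∀ L T → # L ≤ k → HallCondition L T → Matching L T

  split-at-critical : ∀ {k L T S} → Hall≤ k → # L ≤ suc k → HallCondition L T →
                      Critical L T S → Matching L T
  split-at-critical {k} {L} {T} {S} hall #L≤1+k condition (S⊆L , 1≤#S , #S<#L , deficient) =
    matching-mono L⊆S∪Rest covered (union inside outside disjoint)
    where
    inside : Matching S (T ∩ N S)
    inside = hall S (T ∩ N S) (≤-pred (≤-trans #S<#L #L≤1+k)) (condition-inside S⊆L condition)
    outside : Matching (L ∩ compl S) (T ∩ compl (N S))
    outside = hall (L ∩ compl S) (T ∩ compl (N S))
      (≤-pred (≤-trans (+-monoˡ-≤ (# (L ∩ compl S)) 1≤#S) (subst (_≤ suc k) (#-outside S⊆L) #L≤1+k)))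
      (condition-outside S⊆L deficient condition)
    disjoint : ∀ {v} → v ∈ T ∩ N S → v ∉ T ∩ compl (N S)
    disjoint v∈T₁ v∈T₂ = compl⁻ (∩⁻ʳ {X = T} v∈T₂) (∩⁻ʳ {X = T} v∈T₁)
    L⊆S∪Rest : L ⊆ S ∪ (L ∩ compl S)
    L⊆S∪Rest {v} v∈L with v ∈? S
    ... | yes v∈S = ∪⁺ˡ v∈S
    ... | no  v∉S = ∪⁺ʳ (∩⁺ v∈L (compl⁺ v∉S))
    covered : (T ∩ N S) ∪ (T ∩ compl (N S)) ⊆ T
    covered v∈T₁∪T₂ with ∪⁻ v∈T₁∪T₂
    ... | inj₁ v∈T₁ = ∩⁻ˡ v∈T₁
    ... | inj₂ v∈T₂ = ∩⁻ˡ v∈T₂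

  match-one-edge : ∀ {k L T} → Hall≤ k → # L ≤ suc k → HallCondition L T →
                   (∀ S → S ⊆ L → 1 ≤ # S → # S < # L → # S < # (T ∩ N S)) → Matching L T
  match-one-edge {k} {L} {T} hall #L≤1+k condition surplus with empty-or-inhabited L
  ... | inj₁ L≡∅ = empty-matching T L≡∅
  ... | inj₂ (u₀ , u₀∈L) =
    matching-mono ⊆⁅⁆∪─ (⁅⁆∪─⊆ v₀∈T) (union (edge-matching u₀Rv₀) rest ⁅⁆-─-disjoint)
    where
    v₀∈ : ∃ (_∈ T ∩ N ⁅ u₀ ⁆)
    v₀∈ = #-witness (T ∩ N ⁅ u₀ ⁆)
      (subst (_≤ # (T ∩ N ⁅ u₀ ⁆)) (#-⁅⁆ u₀) (condition ⁅ u₀ ⁆ (λ u∈⁅u₀⁆ → subst (_∈ L) (sym (∈⁅⁆⁻ u∈⁅u₀⁆)) u₀∈L)))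
    v₀ = proj₁ v₀∈
    v₀∈T : v₀ ∈ T
    v₀∈T = ∩⁻ˡ (proj₂ v₀∈)
    u₀Rv₀ : R u₀ v₀ ≡ true
    u₀Rv₀ = let u , u∈⁅u₀⁆ , uRv₀ = N⁻ (∩⁻ʳ {X = T} (proj₂ v₀∈)) in subst (λ u → R u v₀ ≡ true) (∈⁅⁆⁻ u∈⁅u₀⁆) uRv₀
    rest : Matching (L ─ u₀) (T ─ v₀)
    rest = hall (L ─ u₀) (T ─ v₀) (≤-pred (subst (_≤ suc k) (#-remove u₀∈L) #L≤1+k))
                (condition-after-edge u₀∈L surplus)

  surplus-without-critical : {L T : VSet n} → ¬ (∃ λ s → Critical L T (Vec.lookup s)) →
    ∀ S → S ⊆ L → 1 ≤ # S → # S < # L → # S < # (T ∩ N S)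
  surplus-without-critical no-critical S S⊆L 1≤#S #S<#L = ≰⇒> λ deficient →
    no-critical (Vec.tabulate S ,
      critical-cong (λ v → sym (lookup∘tabulate S v)) (S⊆L , 1≤#S , #S<#L , deficient))

  -- The case split of the classical proof (is there a critical set?) is decided by
  -- enumerating all subsets.
  hall-≤ : ∀ k → Hall≤ k
  hall-≤ zero L T #L≤0 _ = empty-matching T (λ u∈L → contradiction (≤-trans (#-pos u∈L) #L≤0) λ ())
  hall-≤ (suc k) L T #L≤1+k condition with anySubset? (λ s → critical? L T (Vec.lookup s))
  ... | yes (_ , critical) = split-at-critical (hall-≤ k) #L≤1+k condition critical
  ... | no  no-critical   = match-one-edge (hall-≤ k) #L≤1+k condition (surplus-without-critical no-critical)

  hall : (L T : VSet n) → HallCondition L T → Matching L T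
  hall L T = hall-≤ (# L) L T ≤-refl

module _ {G : Graph n} {col : VSet n} where
  open Hall (adj G) using (Matching; partner; partner∈; partner-related; partner-injective)

  perfect-matching : # col ≡ # (compl col) → (m : Matching col (compl col)) →
    Σ (ESet n) λ M → IsPerfectMatching G M × (∀ {u} → u ∈ col → M u (partner m u) ≡ true)
  perfect-matching #A≡#B m = M , record { sub = sub ; msym = msym ; unique = unique } , M⁺
    where
    p = partner m

    onto : ∀ {v} → v ∈ compl col → ∃[ u ] u ∈ col × p u ≡ v
    onto {v} v∈B with any? (λ u → (u ∈? col) ×-dec (p u ≟ v))
    ... | yes found  = found
    ... | no  missed = contradiction #A≡#B (<⇒≢ (begin-strict
      # col                 ≤⟨ #-injection p into (partner-injective m) ⟩
      # (compl col ─ v)     <⟨ n<1+n _ ⟩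
      suc (# (compl col ─ v)) ≡⟨ #-remove v∈B ⟨
      # (compl col)         ∎))
      where
      open ≤-Reasoning
      into : ∀ {u} → u ∈ col → p u ∈ compl col ─ v
      into u∈A = ─⁺ (partner∈ m u∈A) (λ pu≡v → missed (_ , u∈A , pu≡v))

    M : ESet n
    M u w = (col u ∧ does (w ≟ p u)) ∨ (col w ∧ does (u ≟ p w))

    M⁺ : ∀ {u} → u ∈ col → M u (p u) ≡ true
    M⁺ {u} (member cu) rewrite cu | dec-true (p u ≟ p u) refl = refl

    M⁻ : ∀ {u w} → M u w ≡ true → (u ∈ col × w ≡ p u) ⊎ (w ∈ col × u ≡ p w)
    M⁻ {u} {w} e with col u in cu | w ≟ p u | col w in cw | u ≟ p w
    ... | true | yes w≡pu | _    | _        = inj₁ (member cu , w≡pu)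
    ... | _    | _        | true | yes u≡pw = inj₂ (member cw , u≡pw)

    msym : ∀ u w → M u w ≡ M w u
    msym u w = ∨-comm (col u ∧ does (w ≟ p u)) (col w ∧ does (u ≟ p w))

    sub : ∀ u w → M u w ≡ true → adj G u w ≡ true
    sub u w e with M⁻ e
    ... | inj₁ (u∈A , refl) = partner-related m u∈A
    ... | inj₂ (w∈A , refl) = trans (Graph.sym G (p w) w) (partner-related m w∈A)

    unique : ∀ v → Σ (Fin n) λ u → (M v u ≡ true) × (∀ w → M v w ≡ true → w ≡ u)
    unique v with v ∈? col
    ... | yes v∈A = p v , M⁺ v∈A , λ w e → case-A (M⁻ e)
      where
      case-A : ∀ {w} → (v ∈ col × w ≡ p v) ⊎ (w ∈ col × v ≡ p w) → w ≡ p v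
      case-A (inj₁ (_ , w≡pv))   = w≡pv
      case-A (inj₂ (w∈A , refl)) = ⊥-elim (compl⁻ (partner∈ m w∈A) v∈A)
    ... | no v∉A with onto (compl⁺ v∉A)
    ...   | u , u∈A , refl = u , trans (msym (p u) u) (M⁺ u∈A) , λ w e → case-B (M⁻ e)
      where
      case-B : ∀ {w} → (p u ∈ col × w ≡ p (p u)) ⊎ (w ∈ col × p u ≡ p w) → w ≡ u
      case-B (inj₁ (pu∈A , _))      = ⊥-elim (v∉A pu∈A)
      case-B (inj₂ (w∈A , pu≡pw)) = partner-injective m w∈A u∈A (sym pu≡pw)

#-≤-#N : {G : Graph n} {M : ESet n} → IsPerfectMatching G M → (S : VSet n) → # S ≤ # (Hall.N (adj G) S)
#-≤-#N {G = G} pm S = #-injection mate (λ u∈S → N⁺ u∈S (adj-mate _)) (λ _ _ → mate-injective)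
  where
  open Mate pm
  open Hall (adj G) using (N⁺)

-- Braces

record DisjointEdges (G : Graph n) (P Q : VSet n) : Set where
  field
    {x₁ x₂ y₁ y₂} : Fin n
    x₁∈P  : x₁ ∈ P
    x₂∈P  : x₂ ∈ P
    y₁∈Q  : y₁ ∈ Q
    y₂∈Q  : y₂ ∈ Q
    x₁y₁  : adj G x₁ y₁ ≡ true
    x₂y₂  : adj G x₂ y₂ ≡ true
    x₁≢x₂ : x₁ ≢ x₂
    y₁≢y₂ : y₁ ≢ y₂

disjoint-edges-mono : {G : Graph n} {P P′ Q Q′ : VSet n} → P ⊆ P′ → Q ⊆ Q′ →
                      DisjointEdges G P Q → DisjointEdges G P′ Q′
disjoint-edges-mono P⊆P′ Q⊆Q′ e = record
  { x₁∈P = P⊆P′ x₁∈P ; x₂∈P = P⊆P′ x₂∈P ; y₁∈Q = Q⊆Q′ y₁∈Q ; y₂∈Q = Q⊆Q′ y₂∈Q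
  ; x₁y₁ = x₁y₁ ; x₂y₂ = x₂y₂ ; x₁≢x₂ = x₁≢x₂ ; y₁≢y₂ = y₁≢y₂ }
  where open DisjointEdges e

module _ {G : Graph n} {P Q : VSet n} where
  open Hall (adj G) using (N; N⁻)

  private
    edges-around : ∀ {p β₁ β₂ z} → p ∈ P → β₁ ∈ Q → β₂ ∈ Q → β₁ ≢ β₂ →
                   adj G p β₁ ≡ true → adj G p β₂ ≡ true → z ∈ P ∩ N Q → z ≢ p → DisjointEdges G P Q
    edges-around {p} {β₁} {β₂} {z} p∈P β₁∈Q β₂∈Q β₁≢β₂ pβ₁ pβ₂ z∈ z≢p with N⁻ (∩⁻ʳ {X = P} z∈)
    ... | γ , γ∈Q , γz with γ ≟ β₁
    ...   | yes refl = record
      { x₁∈P = ∩⁻ˡ z∈ ; x₂∈P = p∈P ; y₁∈Q = γ∈Q ; y₂∈Q = β₂∈Q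
      ; x₁y₁ = trans (Graph.sym G z γ) γz ; x₂y₂ = pβ₂ ; x₁≢x₂ = z≢p ; y₁≢y₂ = β₁≢β₂ }
    ...   | no γ≢β₁ = record
      { x₁∈P = ∩⁻ˡ z∈ ; x₂∈P = p∈P ; y₁∈Q = γ∈Q ; y₂∈Q = β₁∈Q
      ; x₁y₁ = trans (Graph.sym G z γ) γz ; x₂y₂ = pβ₁ ; x₁≢x₂ = z≢p ; y₁≢y₂ = γ≢β₁ }

  -- If both vertices of Q ∩ N P are reached from a single p, a vertex of P ∩ N Q other
  -- than p supplies the second edge.
  disjoint-edges : 2 ≤ # (Q ∩ N P) → 2 ≤ # (P ∩ N Q) → DisjointEdges G P Q
  disjoint-edges 2≤#Q∩NP 2≤#P∩NQ with two-elements (Q ∩ N P) 2≤#Q∩NP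
  ... | twoElements {β₁} {β₂} β₁∈ β₂∈ β₁≢β₂
    with N⁻ (∩⁻ʳ {X = Q} β₁∈) | N⁻ (∩⁻ʳ {X = Q} β₂∈)
  ... | p₁ , p₁∈P , p₁β₁ | p₂ , p₂∈P , p₂β₂ with p₁ ≟ p₂
  ...   | no p₁≢p₂ = record
    { x₁∈P = p₁∈P ; x₂∈P = p₂∈P ; y₁∈Q = ∩⁻ˡ β₁∈ ; y₂∈Q = ∩⁻ˡ β₂∈
    ; x₁y₁ = p₁β₁ ; x₂y₂ = p₂β₂ ; x₁≢x₂ = p₁≢p₂ ; y₁≢y₂ = β₁≢β₂ }
  ...   | yes refl with two-elements (P ∩ N Q) 2≤#P∩NQ
  ...     | twoElements {z₁} {z₂} z₁∈ z₂∈ z₁≢z₂ with z₁ ≟ p₁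
  ...       | yes refl   = edges-around p₁∈P (∩⁻ˡ β₁∈) (∩⁻ˡ β₂∈) β₁≢β₂ p₁β₁ p₂β₂ z₂∈ (z₁≢z₂ ∘ sym)
  ...       | no  z₁≢p₁ = edges-around p₁∈P (∩⁻ˡ β₁∈) (∩⁻ˡ β₂∈) β₁≢β₂ p₁β₁ p₂β₂ z₁∈ z₁≢p₁

tight-count : ∀ {s e t a b} → s + e + b ≡ t + a → t + e ≡ suc s → a ≤ e → a + b ≡ 1
tight-count {s} {e} {t} {a} {b} balance deficiency = core e a b (+-cancelˡ-≡ s _ _ (begin
  s + (e + e + b)   ≡⟨ solve (s ∷ e ∷ b ∷ []) ⟩
  (s + e + b) + e   ≡⟨ cong (_+ e) balance ⟩
  (t + a) + e       ≡⟨ solve (t ∷ a ∷ e ∷ []) ⟩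
  (t + e) + a       ≡⟨ cong (_+ a) deficiency ⟩
  suc s + a         ≡⟨ +-suc s a ⟨
  s + suc a         ∎))
  where
  open ≡-Reasoning
  core : ∀ e a b → e + e + b ≡ suc a → a ≤ e → a + b ≡ 1
  core zero          zero          b       eq _   = eq
  core (suc zero)    (suc zero)    zero    _  _   = refl
  core (suc zero)    (suc zero)    (suc b) () _
  core (suc zero)    (suc (suc a)) b       _  (s≤s ())
  core (suc (suc e)) a             b       eq a≤e =
    ⊥-elim (1+n≰n (≤-trans (≤-trans 4+e≤ (≤-reflexive eq)) (s≤s a≤e)))
    where
    4+e≤ : 3 + suc e ≤ suc (suc e) + suc (suc e) + b
    4+e≤ = ≤-trans (s≤s (s≤s (m≤n+m (suc (suc e)) e))) (m≤m+n _ b)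

complement-count : ∀ {s z′ a} → s + suc s + z′ ≡ a + a → 2 + s ≤ a → 2 ≤ z′
complement-count {s} {z′} {a} total 2+s≤a = ≤-trans (n≤1+n 2) (+-cancelˡ-≤ (s + suc s) 3 z′ (begin
  s + suc s + 3         ≡⟨ solve (s ∷ []) ⟩
  (2 + s) + (2 + s)     ≤⟨ +-mono-≤ 2+s≤a 2+s≤a ⟩
  a + a                 ≡⟨ total ⟨
  s + suc s + z′        ∎))
  where open ≤-Reasoning

module Brace {G : Graph n} {col : VSet n} (proper : ProperColouring G col)
             (no-tight : ∀ Z → Nontrivial Z → ¬ Tight G Z)
             {M₀ : ESet n} (pm₀ : IsPerfectMatching G M₀) where
  open Hall (adj G)

  N-colour : {S : VSet n} → S ⊆ col → N S ⊆ compl col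
  N-colour S⊆A v∈NS with N⁻ v∈NS
  ... | u , u∈S , uv = compl⁺ λ v∈A → proper u _ uv (trans (holds (S⊆A u∈S)) (sym (holds v∈A)))

  #A≡#B : # col ≡ # (compl col)
  #A≡#B = Mate.#-colour-classes pm₀ proper

  -- A perfect matching sends S into N S ⊆ Z, so only vertices of E can leave Z on the
  -- A side, and the balance of Z then leaves room for exactly one edge across ∂(Z).
  private
    module Cut {S E : VSet n} (S⊆A : S ⊆ col) (E⊆A : E ⊆ col) (E∩S≡∅ : ∀ {v} → v ∈ E → v ∉ S)
               (deficiency : # (N S) + # E ≡ suc (# S)) where

      Z : VSet n
      Z = (S ∪ E) ∪ N S

      S∪E⊆A : S ∪ E ⊆ col
      S∪E⊆A v∈ with ∪⁻ v∈
      ... | inj₁ v∈S = S⊆A v∈S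
      ... | inj₂ v∈E = E⊆A v∈E

      Z∩A⊆S∪E : Z ∩ col ⊆ S ∪ E
      Z∩A⊆S∪E v∈ with ∪⁻ (∩⁻ˡ v∈)
      ... | inj₁ v∈S∪E = v∈S∪E
      ... | inj₂ v∈NS  = ⊥-elim (compl⁻ (N-colour S⊆A v∈NS) (∩⁻ʳ v∈))

      Z∩B⊆NS : Z ∩ compl col ⊆ N S
      Z∩B⊆NS v∈ with ∪⁻ (∩⁻ˡ v∈)
      ... | inj₁ v∈S∪E = ⊥-elim (compl⁻ (∩⁻ʳ v∈) (S∪E⊆A v∈S∪E))
      ... | inj₂ v∈NS  = v∈NS

      #Z∩A : # (Z ∩ col) ≡ # S + # E
      #Z∩A = trans (#-⊆⊇ Z∩A⊆S∪E (λ v∈ → ∩⁺ (∪⁺ˡ v∈) (S∪E⊆A v∈)))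
                   (#-disjoint-∪ (λ v∈S v∈E → E∩S≡∅ v∈E v∈S))

      #Z∩B : # (Z ∩ compl col) ≡ # (N S)
      #Z∩B = #-⊆⊇ Z∩B⊆NS (λ v∈NS → ∩⁺ (∪⁺ʳ v∈NS) (N-colour S⊆A v∈NS))

      #Z : # Z ≡ # S + suc (# S)
      #Z = begin
        # Z                              ≡⟨ #-partition Z col ⟩
        # (Z ∩ col) + # (Z ∩ compl col)  ≡⟨ cong₂ _+_ #Z∩A #Z∩B ⟩
        # S + # E + # (N S)              ≡⟨ trans (+-assoc (# S) _ _) (cong (# S +_) (+-comm (# E) _)) ⟩
        # S + (# (N S) + # E)            ≡⟨ cong (# S +_) deficiency ⟩
        # S + suc (# S)                  ∎
        where open ≡-Reasoning

      nontrivial : 1 ≤ # S → 2 + # S ≤ # col → Nontrivial Z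
      nontrivial 1≤#S 2+#S≤#A =
        subst (2 ≤_) (sym (trans (∣∣ᵥ≡# Z) #Z)) (+-mono-≤ 1≤#S (s≤s z≤n)) ,
        subst (2 ≤_) (sym (∣∣ᵥ≡# (compl Z))) (complement-count total 2+#S≤#A)
        where
        total : # S + suc (# S) + # (compl Z) ≡ # col + # col
        total = begin
          # S + suc (# S) + # (compl Z)  ≡⟨ cong (_+ # (compl Z)) #Z ⟨
          # Z + # (compl Z)              ≡⟨ #-compl Z ⟩
          n                              ≡⟨ #-compl col ⟨
          # col + # (compl col)          ≡⟨ cong (# col +_) #A≡#B ⟨
          # col + # col                  ∎
          where open ≡-Reasoning

      tight : Tight G Z
      tight M pm = begin
        cutCount M Z                                     ≡⟨ cutCount≡#Leaving Z ⟩
        # (Leaving Z)                                    ≡⟨ #-partition (Leaving Z) col ⟩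
        # (Leaving Z ∩ col) + # (Leaving Z ∩ compl col)  ≡⟨ tight-count balanced deficiency (#-mono leaving⊆E) ⟩
        1                                                ∎
        where
        open ≡-Reasoning
        open Mate pm
        balanced : # S + # E + # (Leaving Z ∩ compl col) ≡ # (N S) + # (Leaving Z ∩ col)
        balanced = subst₂ (λ a b → a + # (Leaving Z ∩ compl col) ≡ b + # (Leaving Z ∩ col))
                          #Z∩A #Z∩B (balance proper Z)
        leaving⊆E : Leaving Z ∩ col ⊆ E
        leaving⊆E {v} v∈ with Leaving⁻ (∩⁻ˡ v∈)
        ... | v∈Z , mv∉Z with ∪⁻ (Z∩A⊆S∪E (∩⁺ v∈Z (∩⁻ʳ {X = Leaving Z} v∈)))
        ...   | inj₂ v∈E = v∈E
        ...   | inj₁ v∈S = ⊥-elim (mv∉Z (∪⁺ʳ (N⁺ v∈S (adj-mate v))))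

  private
    no-deficient-set : ∀ {S E} → S ⊆ col → E ⊆ col → (∀ {v} → v ∈ E → v ∉ S) →
                       # (N S) + # E ≡ suc (# S) → 1 ≤ # S → 2 + # S ≤ # col → ⊥
    no-deficient-set S⊆A E⊆A E∩S≡∅ deficiency 1≤#S 2+#S≤#A =
      no-tight Z (nontrivial 1≤#S 2+#S≤#A) tight
      where open Cut S⊆A E⊆A E∩S≡∅ deficiency

  -- Since # S ≤ # (N S), a shortfall means # (N S) = # S + 1 (take E = ∅) or
  -- # (N S) = # S (take E = ⁅ x ⁆ for some x ∈ A ∖ S).
  surplus : {S : VSet n} → S ⊆ col → 1 ≤ # S → 2 + # S ≤ # col → 2 + # S ≤ # (N S)
  surplus {S} S⊆A 1≤#S 2+#S≤#A with 2 + # S ≤? # (N S)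
  ... | yes enough = enough
  ... | no  short with m≤n⇒m<n∨m≡n (#-≤-#N pm₀ S)
  ...   | inj₁ #S<#NS = ⊥-elim (no-deficient-set S⊆A (⊥-elim ∘ ∉∅) (λ v∈∅ → ⊥-elim (∉∅ v∈∅)) deficiency 1≤#S 2+#S≤#A)
    where
    deficiency : # (N S) + # ∅ ≡ suc (# S)
    deficiency = trans (cong (# (N S) +_) #-∅)
                       (trans (+-identityʳ _) (≤-antisym (s≤s⁻¹ (≰⇒> short)) #S<#NS))
  ...   | inj₂ #S≡#NS with #-witness (col ∩ compl S) (≤-trans (s≤s z≤n) room)
    where
    room : 2 ≤ # (col ∩ compl S)
    room = +-cancelˡ-≤ (# S) 2 _ (subst₂ _≤_ (+-comm 2 (# S)) (#-outside S⊆A) 2+#S≤#A)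
  ...     | x , x∈A∖S = ⊥-elim (no-deficient-set S⊆A ⁅x⁆⊆A ⁅x⁆∩S≡∅ deficiency 1≤#S 2+#S≤#A)
    where
    ⁅x⁆⊆A : ⁅ x ⁆ ⊆ col
    ⁅x⁆⊆A v∈⁅x⁆ = subst (_∈ col) (sym (∈⁅⁆⁻ v∈⁅x⁆)) (∩⁻ˡ x∈A∖S)
    ⁅x⁆∩S≡∅ : ∀ {v} → v ∈ ⁅ x ⁆ → v ∉ S
    ⁅x⁆∩S≡∅ v∈⁅x⁆ v∈S = compl⁻ (∩⁻ʳ {X = col} x∈A∖S) (subst (_∈ S) (∈⁅⁆⁻ v∈⁅x⁆) v∈S)
    deficiency : # (N S) + # ⁅ x ⁆ ≡ suc (# S)
    deficiency = trans (cong (# (N S) +_) (#-⁅⁆ x)) (trans (+-comm _ 1) (cong suc (sym #S≡#NS)))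

  neighbours-across : (X : VSet n) → 1 ≤ # (X ∩ col) → 2 + # (X ∩ col) ≤ # col →
                      # (X ∩ compl col) ≤ # (X ∩ col) → 2 ≤ # ((compl X ∩ compl col) ∩ N (X ∩ col))
  neighbours-across X 1≤#S 2+#S≤#A few = +-cancelˡ-≤ (# (X ∩ col)) 2 _ (begin
    # (X ∩ col) + 2                              ≡⟨ +-comm (# (X ∩ col)) 2 ⟩
    2 + # (X ∩ col)                              ≤⟨ surplus S⊆A 1≤#S 2+#S≤#A ⟩
    # (N (X ∩ col))                              ≡⟨ #-partition (N (X ∩ col)) X ⟩
    # (N (X ∩ col) ∩ X) + # (N (X ∩ col) ∩ compl X)
                                                 ≤⟨ +-mono-≤ (≤-trans (#-mono inside) few) (#-mono outside) ⟩
    # (X ∩ col) + # ((compl X ∩ compl col) ∩ N (X ∩ col)) ∎)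
    where
    open ≤-Reasoning
    S⊆A : X ∩ col ⊆ col
    S⊆A = ∩⁻ʳ {X = X}
    inside : N (X ∩ col) ∩ X ⊆ X ∩ compl col
    inside v∈ = ∩⁺ (∩⁻ʳ {X = N (X ∩ col)} v∈) (N-colour S⊆A (∩⁻ˡ v∈))
    outside : N (X ∩ col) ∩ compl X ⊆ (compl X ∩ compl col) ∩ N (X ∩ col)
    outside v∈ = ∩⁺ (∩⁺ (∩⁻ʳ {X = N (X ∩ col)} v∈) (N-colour S⊆A (∩⁻ˡ v∈))) (∩⁻ˡ v∈)

  hall-minus-two : ∀ {x₁ x₂} y₁ y₂ → x₁ ∈ col → x₂ ∈ col → x₁ ≢ x₂ →
                   HallCondition ((col ─ x₁) ─ x₂) ((compl col ─ y₁) ─ y₂)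
  hall-minus-two {x₁} {x₂} y₁ y₂ x₁∈A x₂∈A x₁≢x₂ S S⊆L with empty-or-inhabited S
  ... | inj₁ S≡∅       = ≤-trans (≤-reflexive (#-empty S≡∅)) z≤n
  ... | inj₂ (_ , v∈S) = +-cancelˡ-≤ 2 _ _ (begin
    2 + # S                                ≤⟨ surplus S⊆A (#-pos v∈S) 2+#S≤#A ⟩
    # (N S)                                ≤⟨ #-≤-suc-remove (N S) y₁ ⟩
    suc (# (N S ─ y₁))                     ≤⟨ s≤s (#-≤-suc-remove (N S ─ y₁) y₂) ⟩
    2 + # ((N S ─ y₁) ─ y₂)                ≤⟨ s≤s (s≤s (#-mono other-neighbours)) ⟩
    2 + # (((compl col ─ y₁) ─ y₂) ∩ N S)  ∎)
    where
    open ≤-Reasoning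
    S⊆A : S ⊆ col
    S⊆A = proj₁ ∘ ─⁻ ∘ proj₁ ∘ ─⁻ ∘ S⊆L
    2+#S≤#A : 2 + # S ≤ # col
    2+#S≤#A = subst (2 + # S ≤_) (sym (trans (#-remove x₁∈A) (cong suc (#-remove (─⁺ x₂∈A (x₁≢x₂ ∘ sym))))))
                    (s≤s (s≤s (#-mono S⊆L)))
    other-neighbours : (N S ─ y₁) ─ y₂ ⊆ ((compl col ─ y₁) ─ y₂) ∩ N S
    other-neighbours v∈ with ─⁻ v∈
    ... | v∈NS─y₁ , v≢y₂ with ─⁻ v∈NS─y₁
    ...   | v∈NS , v≢y₁ = ∩⁺ (─⁺ (─⁺ (N-colour S⊆A v∈NS) v≢y₁) v≢y₂) v∈NS

  extend-to-perfect-matching : (e : DisjointEdges G col (compl col)) →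
    Σ (ESet n) λ M → IsPerfectMatching G M ×
                     M (DisjointEdges.x₁ e) (DisjointEdges.y₁ e) ≡ true ×
                     M (DisjointEdges.x₂ e) (DisjointEdges.y₂ e) ≡ true
  extend-to-perfect-matching e = M , pm , M-x₁y₁ , M-x₂y₂
    where
    open DisjointEdges e

    rest : Matching ((col ─ x₁) ─ x₂) ((compl col ─ y₁) ─ y₂)
    rest = hall _ _ (hall-minus-two y₁ y₂ x₁∈P x₂∈P x₁≢x₂)

    inner : Matching (⁅ x₂ ⁆ ∪ ((col ─ x₁) ─ x₂)) (⁅ y₂ ⁆ ∪ ((compl col ─ y₁) ─ y₂))
    inner = union (edge-matching x₂y₂) rest ⁅⁆-─-disjoint

    outer-disjoint : ∀ {v} → v ∈ ⁅ y₁ ⁆ → v ∉ ⁅ y₂ ⁆ ∪ ((compl col ─ y₁) ─ y₂)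
    outer-disjoint v∈⁅y₁⁆ v∈ with ∪⁻ v∈
    ... | inj₁ v∈⁅y₂⁆ = y₁≢y₂ (trans (sym (∈⁅⁆⁻ v∈⁅y₁⁆)) (∈⁅⁆⁻ v∈⁅y₂⁆))
    ... | inj₂ v∈T    = ⁅⁆-─-disjoint v∈⁅y₁⁆ (proj₁ (─⁻ v∈T))

    outer : Matching (⁅ x₁ ⁆ ∪ (⁅ x₂ ⁆ ∪ ((col ─ x₁) ─ x₂))) (⁅ y₁ ⁆ ∪ (⁅ y₂ ⁆ ∪ ((compl col ─ y₁) ─ y₂)))
    outer = union (edge-matching x₁y₁) inner outer-disjoint

    matching : Matching col (compl col)
    matching = matching-mono A-covered B-covered outer
      where
      A-covered : col ⊆ ⁅ x₁ ⁆ ∪ (⁅ x₂ ⁆ ∪ ((col ─ x₁) ─ x₂))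
      A-covered v∈A = ∪-monoʳ (⊆⁅⁆∪─ {X = col ─ x₁}) (⊆⁅⁆∪─ v∈A)
      B-covered : ⁅ y₁ ⁆ ∪ (⁅ y₂ ⁆ ∪ ((compl col ─ y₁) ─ y₂)) ⊆ compl col
      B-covered v∈ = ⁅⁆∪─⊆ y₁∈Q (∪-monoʳ (⁅⁆∪─⊆ (─⁺ y₂∈Q (y₁≢y₂ ∘ sym))) v∈)

    completion = perfect-matching #A≡#B matching
    M   = proj₁ completion
    pm  = proj₁ (proj₂ completion)
    M⁺  = proj₂ (proj₂ completion)

    M-x₁y₁ : M x₁ y₁ ≡ true
    M-x₁y₁ = subst (λ y → M x₁ y ≡ true)
      (union-partnerˡ (edge-matching x₁y₁) inner outer-disjoint (∈⁅⁆ x₁)) (M⁺ x₁∈P)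

    M-x₂y₂ : M x₂ y₂ ≡ true
    M-x₂y₂ = subst (λ y → M x₂ y ≡ true)
      (trans (union-partnerʳ (edge-matching x₁y₁) inner outer-disjoint (x₁≢x₂ ∘ sym ∘ ∈⁅⁆⁻))
             (union-partnerˡ (edge-matching x₂y₂) rest ⁅⁆-─-disjoint (∈⁅⁆ x₂))) (M⁺ x₂∈P)

compl-proper : {G : Graph n} {col : VSet n} → ProperColouring G col → ProperColouring G (compl col)
compl-proper proper u v uv = proper u v uv ∘ not-injective

2≤half : ∀ {a} → 4 ≤ a + a → 2 ≤ a
2≤half {suc (suc a)} _ = s≤s (s≤s z≤n)
2≤half {suc zero} (s≤s (s≤s ()))

4≤complement : ∀ {x y m} → 4 ≤ x → x ≤ m ∸ 4 → x + y ≡ m → 4 ≤ y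
4≤complement {x} {y} {m} 4≤x x≤m∸4 x+y≡m = +-cancelˡ-≤ x 4 y
  (≤-trans (m≤o∸n⇒m+n≤o x 4≤m x≤m∸4) (≤-reflexive (sym x+y≡m)))
  where
  4≤m : 4 ≤ m
  4≤m = ≤-trans 4≤x (≤-trans x≤m∸4 (m∸n≤m m 4))

∣m-n∣≡2 : ∀ {a b x y} → x + y ≡ 2 → a + y ≡ b + x → a ≢ b → ∣ a - b ∣ ≡ 2
∣m-n∣≡2 {a} {b} {zero}          {suc (suc zero)} _ a+2≡b _   =
  trans (cong ∣ a -_∣ (trans (sym (+-identityʳ b)) (sym a+2≡b))) (∣m-m+n∣≡n a 2)
∣m-n∣≡2 {a} {b} {suc zero}      {suc zero}       _ a+1≡b+1 a≢b = ⊥-elim (a≢b (+-cancelʳ-≡ 1 a b a+1≡b+1))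
∣m-n∣≡2 {a} {b} {suc (suc zero)} {zero}          _ a≡b+2 _   =
  trans (∣-∣-comm a b) (trans (cong ∣ b -_∣ (trans (sym (+-identityʳ a)) a≡b+2)) (∣m-m+n∣≡n b 2))

module _ {G : Graph n} {col : VSet n} (proper : ProperColouring G col)
         (no-tight : ∀ Z → Nontrivial Z → ¬ Tight G Z)
         {M₀ : ESet n} (pm₀ : IsPerfectMatching G M₀) where
  open Hall (adj G) using (N)
  private
    module A = Brace proper no-tight pm₀
    module B = Brace (compl-proper {G = G} proper) no-tight pm₀

  complement-balanced : (X : VSet n) → # (X ∩ col) ≡ # (X ∩ compl col) →
                        # (compl X ∩ col) ≡ # (compl X ∩ compl col)
  complement-balanced X a≡b = +-cancelˡ-≡ (# (X ∩ col)) _ _ (begin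
    # (X ∩ col) + # (compl X ∩ col)              ≡⟨ #-partitionˡ X col ⟨
    # col                                        ≡⟨ A.#A≡#B ⟩
    # (compl col)                                ≡⟨ #-partitionˡ X (compl col) ⟩
    # (X ∩ compl col) + # (compl X ∩ compl col)  ≡⟨ cong (_+ # (compl X ∩ compl col)) a≡b ⟨
    # (X ∩ col) + # (compl X ∩ compl col)        ∎)
    where open ≡-Reasoning

  crossing-edges : (X : VSet n) → # (X ∩ col) ≡ # (X ∩ compl col) → 4 ≤ # X → 4 ≤ # (compl X) →
                   DisjointEdges G (X ∩ col) (compl X ∩ compl col)
  crossing-edges X a≡b 4≤#X 4≤#X̄ = disjoint-edges from-inside from-outside
    where
    open ≤-Reasoning
    a′≡b′ = complement-balanced X a≡b

    2≤#P : 2 ≤ # (X ∩ col)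
    2≤#P = 2≤half (subst (4 ≤_) (trans (#-partition X col) (cong (# (X ∩ col) +_) (sym a≡b))) 4≤#X)

    2≤#Q : 2 ≤ # (compl X ∩ compl col)
    2≤#Q = 2≤half (subst (4 ≤_) (trans (#-partition (compl X) col) (cong (_+ # (compl X ∩ compl col)) a′≡b′)) 4≤#X̄)

    2+#P≤#A : 2 + # (X ∩ col) ≤ # col
    2+#P≤#A = begin
      2 + # (X ∩ col)                  ≤⟨ +-monoˡ-≤ (# (X ∩ col)) (≤-trans 2≤#Q (≤-reflexive (sym a′≡b′))) ⟩
      # (compl X ∩ col) + # (X ∩ col)  ≡⟨ +-comm (# (compl X ∩ col)) _ ⟩
      # (X ∩ col) + # (compl X ∩ col)  ≡⟨ #-partitionˡ X col ⟨
      # col                            ∎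

    2+#Q≤#B : 2 + # (compl X ∩ compl col) ≤ # (compl col)
    2+#Q≤#B = begin
      2 + # (compl X ∩ compl col)                  ≤⟨ +-monoˡ-≤ (# (compl X ∩ compl col)) (≤-trans 2≤#P (≤-reflexive a≡b)) ⟩
      # (X ∩ compl col) + # (compl X ∩ compl col)  ≡⟨ #-partitionˡ X (compl col) ⟨
      # (compl col)                                ∎

    from-inside : 2 ≤ # ((compl X ∩ compl col) ∩ N (X ∩ col))
    from-inside = A.neighbours-across X (≤-trans (s≤s z≤n) 2≤#P) 2+#P≤#A (≤-reflexive (sym a≡b))

    from-outside : 2 ≤ # ((X ∩ col) ∩ N (compl X ∩ compl col))
    from-outside = ≤-trans
      (B.neighbours-across (compl X) (≤-trans (s≤s z≤n) 2≤#Q) 2+#Q≤#B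
        (≤-trans (≤-reflexive (#-cong λ v → cong (not (X v) ∧_) (not-involutive (col v))))
                 (≤-reflexive a′≡b′)))
      (#-mono (∩-monoˡ back))
      where
      back : compl (compl X) ∩ compl (compl col) ⊆ X ∩ col
      back v∈ = ∩⁺ (compl-compl⁻ (∩⁻ˡ v∈)) (compl-compl⁻ (∩⁻ʳ {X = compl (compl X)} v∈))

  balanced-set-has-large-cut : (X : VSet n) → # (X ∩ col) ≡ # (X ∩ compl col) →
    4 ≤ # X → 4 ≤ # (compl X) → ∃[ M ] IsPerfectMatching G M × 4 ≤ cutCount M X
  balanced-set-has-large-cut X a≡b 4≤#X 4≤#X̄ = M , pm , (begin
    4                                                ≤⟨ +-mono-≤ 2≤lA (subst (2 ≤_) (sym lB≡lA) 2≤lA) ⟩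
    # (Leaving X ∩ col) + # (Leaving X ∩ compl col)  ≡⟨ #-partition (Leaving X) col ⟨
    # (Leaving X)                                    ≡⟨ cutCount≡#Leaving X ⟨
    cutCount M X                                     ∎)
    where
    open ≤-Reasoning
    e = crossing-edges X a≡b 4≤#X 4≤#X̄
    open DisjointEdges e

    extension = A.extend-to-perfect-matching (disjoint-edges-mono ∩⁻ʳ ∩⁻ʳ e)
    M  = proj₁ extension
    pm = proj₁ (proj₂ extension)
    open Mate pm

    leaving : ∀ {x y} → x ∈ X ∩ col → y ∈ compl X ∩ compl col → M x y ≡ true → x ∈ Leaving X ∩ col
    leaving x∈ y∈ Mxy = ∩⁺ (Leaving⁺ (∩⁻ˡ x∈) λ mx∈X → compl⁻ (∩⁻ˡ y∈) (subst (_∈ X) (sym (mate-unique Mxy)) mx∈X))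
                           (∩⁻ʳ x∈)

    2≤lA : 2 ≤ # (Leaving X ∩ col)
    2≤lA = #-two (twoElements (leaving x₁∈P y₁∈Q (proj₁ (proj₂ (proj₂ extension))))
                              (leaving x₂∈P y₂∈Q (proj₂ (proj₂ (proj₂ extension)))) x₁≢x₂)

    lB≡lA : # (Leaving X ∩ compl col) ≡ # (Leaving X ∩ col)
    lB≡lA = +-cancelˡ-≡ (# (X ∩ col)) _ _ (trans (balance proper X) (cong (_+ # (Leaving X ∩ col)) (sym a≡b)))

lemma10 : (n : ℕ) (G : Graph n) (col : VSet n) (X : VSet n) →
    IsBrace G col → MpEq G X 2 → 4 ≤ ∣ X ∣ᵥ → ∣ X ∣ᵥ ≤ n ∸ 4 →
    ∣ ∣ X ∩ col ∣ᵥ - ∣ X ∩ compl col ∣ᵥ ∣ ≡ 2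
lemma10 n G col X (proper , _ , no-tight) ((M₀ , pm₀ , cut≡2) , cut≤2) 4≤∣X∣ ∣X∣≤n∸4 =
  subst₂ (λ a b → ∣ a - b ∣ ≡ 2) (sym (∣∣ᵥ≡# (X ∩ col))) (sym (∣∣ᵥ≡# (X ∩ compl col)))
         (∣m-n∣≡2 leaving≡2 (balance {col = col} proper X) unbalanced)
  where
  open Mate pm₀

  leaving≡2 : # (Leaving X ∩ col) + # (Leaving X ∩ compl col) ≡ 2
  leaving≡2 = trans (sym (#-partition (Leaving X) col)) (trans (sym (cutCount≡#Leaving X)) cut≡2)

  4≤#X : 4 ≤ # X
  4≤#X = subst (4 ≤_) (∣∣ᵥ≡# X) 4≤∣X∣

  4≤#X̄ : 4 ≤ # (compl X)
  4≤#X̄ = 4≤complement 4≤#X (subst (_≤ n ∸ 4) (∣∣ᵥ≡# X) ∣X∣≤n∸4) (#-compl X)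

  unbalanced : # (X ∩ col) ≢ # (X ∩ compl col)
  unbalanced a≡b =
    let M , pm , 4≤cut = balanced-set-has-large-cut {G = G} {col = col} proper no-tight pm₀ X a≡b 4≤#X 4≤#X̄
    in contradiction (≤-trans 4≤cut (cut≤2 M pm)) λ { (s≤s (s≤s ())) }
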